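{- Let $k\geq 2$ be an integer and let $G=(D\cup I,E)$ be a split graph such that its corresponding hypergraph $H(G)$ is $k$-uniform. If there exists $x_D\in D$ that is adjacent to every vertex of $I$, then $G$ does not have $k$ completely independent spanning trees.
   Context: A split graph $G=(D\cup I,E)$ is a graph whose vertex set is partitioned into a clique $D$ and an independent set $I$; the paper assumes throughout that every vertex of $D$ is adjacent to at least one vertex of $I$. Its corresponding hypergraph is $H(G)=(D,\mathcal{E})$ with $\mathcal{E}=\{N_G(x) : x\in I\}$ (one hyperedge for each $x\in I$). $H(G)$ is $k$-uniform if every vertex of $I$ has exactly $k$ neighbors in $G$. Spanning trees $T_1,\dots,T_k$ of a graph are completely independent spanning trees if for every pair of vertices $x,y$ the $(x,y)$-paths in $T_1,\dots,T_k$ are pairwise edge-disjoint and have no common internal vertex. -}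

module Defs where

open import Data.Nat using (ℕ; _≤_)
open import Data.Fin using (Fin)
open import Data.Fin.Subset using (Subset; ∣_∣)
open import Data.Bool using (Bool; true; false; not)
open import Data.List using (List; []; _∷_; length)
open import Data.List.Relation.Unary.Unique.Propositional using (Unique)
open import Data.List.Membership.Propositional using (_∈_; _∉_)
open import Data.Product using (Σ; _×_; _,_; ∃)
open import Data.Vec using (tabulate)
open import Relation.Binary.PropositionalEquality using (_≡_; _≢_)
open import Relation.Nullary using (¬_)

record Graph (n : ℕ) : Set where
  field
    adj   : Fin n → Fin n → Bool
    sym   : ∀ u v → adj u v ≡ adj v u
    irrefl : ∀ u → adj u u ≡ false
open Graph public

module _ {n : ℕ} where

  Edge : (Fin n → Fin n → Bool) → Fin n → Fin n → Set
  Edge E u v = E u v ≡ true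

  data Walk (E : Fin n → Fin n → Bool) : Fin n → Fin n → Set where
    []  : ∀ {x} → Walk E x x
    _∷_ : ∀ {x y z} → Edge E x y → Walk E y z → Walk E x z

  vertices : ∀ {E x y} → Walk E x y → List (Fin n)
  vertices {x = x} []      = x ∷ []
  vertices {x = x} (_ ∷ w) = x ∷ vertices w

  edges : ∀ {E x y} → Walk E x y → List (Fin n × Fin n)
  edges []                  = []
  edges {x = x} (_∷_ {y = y} _ w) = (x , y) ∷ edges w

  internal : ∀ {E x y} → Walk E x y → List (Fin n)
  internal []                      = []
  internal (_ ∷ [])                = []
  internal (_∷_ {y = y} _ (e ∷ w)) = y ∷ internal (e ∷ w)

  len : ∀ {E x y} → Walk E x y → ℕ
  len []      = 0
  len (_ ∷ w) = Data.Nat.suc (len w)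

  IsPath : ∀ {E x y} → Walk E x y → Set
  IsPath w = Unique (vertices w)

  HasCycle : (Fin n → Fin n → Bool) → Set
  HasCycle E = Σ (Fin n) λ x → Σ (Fin n) λ y → Σ (Walk E x y) λ w →
                 IsPath w × (2 ≤ len w) × Edge E y x

  Connected : (Fin n → Fin n → Bool) → Set
  Connected E = ∀ x y → Walk E x y

  record SpanningTree (G : Graph n) : Set where
    field
      T       : Fin n → Fin n → Bool
      T-sym   : ∀ u v → T u v ≡ T v u
      T⊆G     : ∀ u v → T u v ≡ true → adj G u v ≡ true
      T-conn  : Connected T
      T-acyc  : ¬ HasCycle T
  open SpanningTree public

  EdgeDisjoint : ∀ {E F x y u v} → Walk E x y → Walk F u v → Set
  EdgeDisjoint p q = ∀ a b → (a , b) ∈ edges p →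
                       ((a , b) ∉ edges q) × ((b , a) ∉ edges q)

  InternallyDisjoint : ∀ {E F x y u v} → Walk E x y → Walk F u v → Set
  InternallyDisjoint p q = ∀ a → a ∈ internal p → a ∉ internal q

  CompletelyIndependent : {G : Graph n} {k : ℕ} → (Fin k → SpanningTree G) → Set
  CompletelyIndependent {k = k} Ts =
    ∀ (i j : Fin k) → i ≢ j → ∀ (x y : Fin n) →
    (p : Walk (T (Ts i)) x y) → IsPath p →
    (q : Walk (T (Ts j)) x y) → IsPath q →
    EdgeDisjoint p q × InternallyDisjoint p q

  -- split graph: vertex set partitioned into D (inD v ≡ true) and
  -- I (inD v ≡ false); D a clique, I an independent set, and (standing
  -- assumption of the paper) every vertex of D has a neighbour in I.
  record IsSplit (G : Graph n) (inD : Fin n → Bool) : Set where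
    field
      clique      : ∀ u v → inD u ≡ true → inD v ≡ true → u ≢ v → adj G u v ≡ true
      independent : ∀ u v → inD u ≡ false → inD v ≡ false → adj G u v ≡ false
      D-has-I-nbr : ∀ u → inD u ≡ true → Σ (Fin n) λ x → (inD x ≡ false) × (adj G u x ≡ true)

  nbhd : Graph n → Fin n → Subset n
  nbhd G x = tabulate (adj G x)

  -- H(G) = (D, {N_G(x) : x ∈ I}) is k-uniform: every hyperedge has size k
  KUniform : (G : Graph n) (inD : Fin n → Bool) (k : ℕ) → Set
  KUniform G inD k = ∀ x → inD x ≡ false → ∣ nbhd G x ∣ ≡ k

-- In completely independent spanning trees an edge lies in at most one tree, and a vertex is
-- inner (has two tree neighbours) in at most one tree, since otherwise it is internal to the
-- paths between the same two vertices in two trees. A vertex of I has exactly k neighbours and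
-- meets an edge of each of the k trees, so it is a leaf of every tree and each of its edges
-- lies in some tree. Let w ∈ I be a neighbour of xD and T_a the tree containing w xD. An inner
-- vertex t ≠ xD of T_a lies in D; for a neighbour w′ ∈ I of t, the trees containing w′ t and
-- w′ xD make t or xD inner in a second tree. Yet T_a has such a vertex: for b ≠ a and a
-- T_b-neighbour y of xD, the T_a-path from y to xD is not the single edge y xD.
module Submission where

open import Defs hiding (sym)
open import Data.Nat using (ℕ; _≤_; suc; s≤s; z≤n)
open import Data.Nat.Properties using (≤-trans; ≤-reflexive; 1+n≰n)
open import Data.Fin using (Fin; zero; _≟_; punchIn)
open import Data.Fin.Properties using (any?; punchInᵢ≢i)
open import Data.Fin.Subset using (Subset; ∣_∣; _-_) renaming (_∈_ to _∈ₛ_)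
open import Data.Fin.Subset.Properties using (x∈p∧x≢y⇒x∈p-y; x∈p⇒∣p-x∣<∣p∣)
open import Data.Bool using (Bool; true; false)
open import Data.Product using (Σ; ∃; _×_; _,_; proj₁; proj₂)
open import Data.Sum using (_⊎_; inj₁; inj₂)
open import Data.List using (List; []; _∷_; length; map; allFin)
open import Data.List.Properties using (length-map; length-tabulate)
open import Data.List.Relation.Unary.Any using (here; there)
open import Data.List.Relation.Unary.All using ([]; _∷_)
open import Data.List.Relation.Unary.All.Properties using (All¬⇒¬Any; ¬Any⇒All¬)
open import Data.List.Relation.Unary.AllPairs as AllPairs using ([]; _∷_)
open import Data.List.Relation.Unary.Unique.Propositional using (Unique)
open import Data.List.Relation.Unary.Unique.Propositional.Properties
  using (map⁺; allFin⁺; Unique[x∷xs]⇒x∉xs)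
open import Data.List.Relation.Binary.Subset.Propositional using (_⊆_)
open import Data.List.Membership.Propositional using (_∈_; _∉_)
open import Data.List.Membership.Propositional.Properties using (∈-map⁻)
open import Data.Vec using (tabulate)
open import Data.Vec.Properties using (lookup⇒[]=; lookup∘tabulate)
open import Data.Empty using (⊥-elim)
open import Data.Unit using (⊤; tt)
open import Relation.Binary.PropositionalEquality
  using (_≡_; _≢_; refl; sym; trans; subst)
open import Relation.Nullary using (¬_; yes; no)
open import Function using (_∘_)

length≤∣p∣ : ∀ {m} (p : Subset m) {xs : List (Fin m)} →
             Unique xs → (∀ {x} → x ∈ xs → x ∈ₛ p) → length xs ≤ ∣ p ∣
length≤∣p∣ p {[]}     _            _    = z≤n
length≤∣p∣ p {x ∷ xs} (x∉xs ∷ !xs) xs⊆p =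
  ≤-trans (s≤s (length≤∣p∣ (p - x) !xs xs⊆p-x)) (x∈p⇒∣p-x∣<∣p∣ (xs⊆p (here refl)))
  where
  xs⊆p-x : ∀ {y} → y ∈ xs → y ∈ₛ p - x
  xs⊆p-x {y} y∈xs = x∈p∧x≢y⇒x∈p-y (xs⊆p (there y∈xs))
                      (λ y≡x → All¬⇒¬Any x∉xs (subst (_∈ xs) y≡x y∈xs))

adj⇒∈nbhd : ∀ {n} (G : Graph n) {v u} → adj G v u ≡ true → u ∈ₛ nbhd G v
adj⇒∈nbhd G {v} {u} v~u =
  lookup⇒[]= u (tabulate (adj G v)) (trans (lookup∘tabulate (adj G v) u) v~u)

module Walks {n : ℕ} (E : Fin n → Fin n → Bool) where

  open import Data.List.Membership.DecPropositional {A = Fin n} _≟_ using (_∈?_)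

  head∈vertices : ∀ {x y} (w : Walk E x y) → x ∈ vertices w
  head∈vertices []      = here refl
  head∈vertices (_ ∷ _) = here refl

  last∈vertices : ∀ {x y} (w : Walk E x y) → y ∈ vertices w
  last∈vertices []      = here refl
  last∈vertices (_ ∷ w) = there (last∈vertices w)

  start≢end : ∀ {x y z} (w : Walk E y z) → Unique (x ∷ vertices w) → x ≢ z
  start≢end w !xw refl = Unique[x∷xs]⇒x∉xs !xw (last∈vertices w)

  start≢third : ∀ {x y u z} (w : Walk E u z) → Unique (x ∷ y ∷ vertices w) → x ≢ u
  start≢third w !xyw refl = Unique[x∷xs]⇒x∉xs !xyw (there (head∈vertices w))

  prefix : ∀ {x y v} (w : Walk E x y) → IsPath w → v ∈ vertices w →
           Σ (Walk E x v) λ q → IsPath q × vertices q ⊆ vertices w × (v ≢ x → 1 ≤ len q)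
  prefix []      _ (here refl) = [] , [] ∷ [] , (λ v∈ → v∈) , λ v≢v → ⊥-elim (v≢v refl)
  prefix (e ∷ w) _ (here refl) =
    [] , [] ∷ [] , (λ { (here refl) → here refl }) , λ v≢v → ⊥-elim (v≢v refl)
  prefix (e ∷ w) p@(_ ∷ !w) (there v∈w) with prefix w !w v∈w
  ... | q , !q , q⊆w , _ =
    e ∷ q , ¬Any⇒All¬ (vertices q) (λ x∈q → Unique[x∷xs]⇒x∉xs p (q⊆w x∈q)) ∷ !q ,
    (λ { (here refl) → here refl ; (there a∈q) → there (q⊆w a∈q) }) , λ _ → s≤s z≤n

  suffix : ∀ {x y v} (w : Walk E x y) → IsPath w → v ∈ vertices w → Σ (Walk E v y) IsPath
  suffix []      !w (here refl)    = [] , !w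
  suffix (e ∷ w) !w (here refl)    = e ∷ w , !w
  suffix (e ∷ w) (_ ∷ !w) (there v∈w) = suffix w !w v∈w

  walk⇒path : ∀ {x y} → Walk E x y → Σ (Walk E x y) IsPath
  walk⇒path [] = [] , [] ∷ []
  walk⇒path {x} (e ∷ w) with walk⇒path w
  ... | q , !q with x ∈? vertices q
  ...   | yes x∈q = suffix q !q x∈q
  ...   | no  x∉q = e ∷ q , ¬Any⇒All¬ (vertices q) x∉q ∷ !q

  ∈-internal : ∀ {x y v} (w : Walk E x y) → v ∈ vertices w → v ≢ x → v ≢ y → v ∈ internal w
  ∈-internal []            (here refl)         v≢x _   = ⊥-elim (v≢x refl)
  ∈-internal (e ∷ [])      (here refl)         v≢x _   = ⊥-elim (v≢x refl)
  ∈-internal (e ∷ [])      (there (here refl)) _   v≢y = ⊥-elim (v≢y refl)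
  ∈-internal (e ∷ e′ ∷ w)  (here refl)         v≢x _   = ⊥-elim (v≢x refl)
  ∈-internal {v = v} (_∷_ {y = u} e (e′ ∷ w)) (there v∈) _ v≢y with v ≟ u
  ... | yes refl = here refl
  ... | no  v≢u  = there (∈-internal (e′ ∷ w) v∈ v≢u v≢y)

module Forest {n : ℕ} (E : Fin n → Fin n → Bool)
  (E-sym : ∀ u v → E u v ≡ E v u)
  (loopless : ∀ u → ¬ Edge E u u)
  (acyclic : ¬ HasCycle E) where

  open Walks E public

  edge-sym : ∀ {u v} → Edge E u v → Edge E v u
  edge-sym {u} {v} e = trans (E-sym v u) e

  edge⇒≢ : ∀ {u v} → Edge E u v → u ≢ v
  edge⇒≢ {u} e refl = loopless u e

  edge-IsPath : ∀ {u v} (e : Edge E u v) → IsPath {E = E} (e ∷ [])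
  edge-IsPath e = (edge⇒≢ e ∷ []) ∷ [] ∷ []

  Inner : Fin n → Set
  Inner z = Σ (Fin n) λ p → Σ (Fin n) λ q → Edge E z p × Edge E z q × p ≢ q

  Inner-avoiding : ∀ {z} → Inner z → ∀ h → Σ (Fin n) λ x → Edge E z x × x ≢ h
  Inner-avoiding (p , q , ep , eq , p≢q) h with p ≟ h
  ... | yes refl = q , eq , λ q≡p → p≢q (sym q≡p)
  ... | no  p≢h  = p , ep , p≢h

  second-Inner : ∀ {x t u y} (e : Edge E x t) (e′ : Edge E t u) (w : Walk E u y) →
                 IsPath (e ∷ e′ ∷ w) → Inner t × t ≢ y
  second-Inner e e′ w p =
    (_ , _ , edge-sym e , e′ , start≢third w p) , start≢end w (AllPairs.tail p)

  record Route (z x : Fin n) : Set where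
    constructor route
    field
      next   : Fin n
      step   : Edge E z next
      rest   : Walk E next x
      isPath : IsPath {E = E} (step ∷ rest)
  open Route public

  walk⇒Route : ∀ {z x} → z ≢ x → Walk E z x → Route z x
  walk⇒Route z≢x w with walk⇒path w
  ... | []    , _  = ⊥-elim (z≢x refl)
  ... | e ∷ q , !p = route _ e q !p

  edge⇒Route : ∀ {z p} → Edge E z p → Route z p
  edge⇒Route e = route _ e [] (edge-IsPath e)

  -- z is an internal vertex of the tree path from x to y
  Between : Fin n → Fin n → Fin n → Set
  Between z x y = Σ (Route z x) λ r → Σ (Route z y) λ s → next r ≢ next s

  private
    -- Closing a path z q ⋯ p back to z through a second edge z p would be a cycle.
    no-chord : ∀ {z p q y} (e : Edge E z q) (w : Walk E q y) → IsPath (e ∷ w) →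
               Edge E z p → p ≢ q → p ∉ vertices w
    no-chord {z} {p} e w path@(_ ∷ !w) z~p p≢q p∈w with prefix w !w p∈w
    ... | q , !q , q⊆w , 1≤len =
      acyclic (z , p , e ∷ q , z∉q ∷ !q , s≤s (1≤len p≢q) , edge-sym z~p)
      where z∉q = ¬Any⇒All¬ (vertices q) (λ z∈q → Unique[x∷xs]⇒x∉xs path (q⊆w z∈q))

    Diverging : ∀ {z a b} → Walk E z a → Walk E z b → Set
    Diverging (_∷_ {y = p} _ _) (_∷_ {y = q} _ _) = p ≢ q
    Diverging _ _ = ⊤

    second∉ : ∀ {z p a b} (e : Edge E z p) (P : Walk E p a) (Q : Walk E z b) →
              IsPath Q → Diverging (e ∷ P) Q → p ∉ vertices Q
    second∉ e P []       _ _   (here refl)  = edge⇒≢ e refl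
    second∉ e P (e′ ∷ Q) _ _   (here refl)  = edge⇒≢ e refl
    second∉ e P (e′ ∷ Q) !Q p≢q (there p∈Q) = no-chord e′ Q !Q e p≢q p∈Q

    back-Diverging : ∀ {z p a b} (e : Edge E z p) (P : Walk E p a) → IsPath (e ∷ P) →
                     (Q : Walk E z b) → Diverging P (edge-sym e ∷ Q)
    back-Diverging e []       _ Q = tt
    back-Diverging e (e′ ∷ P) p Q = λ u≡z → start≢third P p (sym u≡z)

    -- Moves the edges of P, reversed, onto the front of Q; acyclicity keeps the result a path.
    join : ∀ {z a b} (P : Walk E z a) → IsPath P → (Q : Walk E z b) → IsPath Q →
           Diverging P Q → Σ (Walk E a b) λ R → IsPath R × vertices Q ⊆ vertices R
    join []      _  Q !Q _ = Q , !Q , λ v∈ → v∈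
    join (e ∷ P) !P Q !Q d
      with join P (AllPairs.tail !P) (edge-sym e ∷ Q)
                (¬Any⇒All¬ (vertices Q) (second∉ e P Q !Q d) ∷ !Q) (back-Diverging e P !P Q)
    ... | R , !R , Q⊆R = R , !R , λ v∈ → Q⊆R (there v∈)

  Between⇒internal : ∀ {z x y} → Between z x y →
                     Σ (Walk E x y) λ R → IsPath R × z ∈ internal R
  Between⇒internal (route _ e w !x , route _ e′ w′ !y , d) with join (e ∷ w) !x (e′ ∷ w′) !y d
  ... | R , !R , Q⊆R =
    R , !R , ∈-internal R (Q⊆R (here refl)) (start≢end w !x) (start≢end w′ !y)

  Between-either : ∀ {z p q x} → Edge E z p → Edge E z q → p ≢ q → Route z x →
                   Between z x p ⊎ Between z x q
  Between-either {p = p} ep eq p≢q r with next r ≟ p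
  ... | no  r≢p  = inj₁ (r , edge⇒Route ep , r≢p)
  ... | yes refl = inj₂ (r , edge⇒Route eq , p≢q)

  leaf-neighbour⇒Inner : ∀ {z ℓ x} → Edge E z ℓ → ¬ Inner ℓ → Route z x → ℓ ≢ x → Inner z
  leaf-neighbour⇒Inner {ℓ = ℓ} zℓ ¬inner (route h e w !w) ℓ≢x with h ≟ ℓ | w
  ... | no  h≢ℓ  | _       = _ , _ , e , zℓ , h≢ℓ
  ... | yes refl | []      = ⊥-elim (ℓ≢x refl)
  ... | yes refl | e′ ∷ w′ = ⊥-elim (¬inner (proj₁ (second-Inner e e′ w′ !w)))

module CISTs {n : ℕ} {G : Graph n} {k : ℕ}
  (Ts : Fin k → SpanningTree G) (cist : CompletelyIndependent Ts) where

  loopless : ∀ i u → ¬ Edge (T (Ts i)) u u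
  loopless i u e with trans (sym (T⊆G (Ts i) u u e)) (irrefl G u)
  ... | ()

  module Tree (i : Fin k) = Forest (T (Ts i)) (T-sym (Ts i)) (loopless i) (T-acyc (Ts i))
  open Tree public

  toward : ∀ i {z x} → z ≢ x → Route i z x
  toward i {z} {x} z≢x = walk⇒Route i z≢x (T-conn (Ts i) z x)

  edge-in-one-tree : ∀ {i j} → i ≢ j → ∀ {u v} → Edge (T (Ts i)) u v → ¬ Edge (T (Ts j)) u v
  edge-in-one-tree {i} {j} i≢j e e′ =
    proj₁ (proj₁ (cist i j i≢j _ _ (e ∷ []) (edge-IsPath i e) (e′ ∷ []) (edge-IsPath j e′))
                 _ _ (here refl))
          (here refl)

  Between-in-one-tree : ∀ {i j} → i ≢ j → ∀ {z x y} → Between i z x y → ¬ Between j z x y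
  Between-in-one-tree {i} {j} i≢j b b′ with Between⇒internal i b | Between⇒internal j b′
  ... | R , !R , z∈R | R′ , !R′ , z∈R′ = proj₂ (cist i j i≢j _ _ R !R R′ !R′) _ z∈R z∈R′

  -- If the T_j-routes from z to p and to q leave z by different edges, z separates p and q in
  -- both trees; otherwise a T_j-neighbour x of z off that edge is separated by z from p and q
  -- in T_j, and from one of them in T_i.
  Inner-in-one-tree : ∀ {i j} → i ≢ j → ∀ {z} → Inner i z → ¬ Inner j z
  Inner-in-one-tree {i} {j} i≢j (p , q , ep , eq , p≢q) innerʲ
    with toward j (edge⇒≢ i ep) | toward j (edge⇒≢ i eq)
  ... | rp | rq with next rp ≟ next rq
  ... | no rp≢rq =
    Between-in-one-tree i≢j (edge⇒Route i ep , edge⇒Route i eq , p≢q) (rp , rq , rp≢rq)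
  ... | yes rp≡rq with Inner-avoiding j innerʲ (next rp)
  ...   | x , ex , x≢rp with Between-either i ep eq p≢q (toward i (edge⇒≢ j ex))
  ...     | inj₁ b = Between-in-one-tree i≢j b (edge⇒Route j ex , rp , x≢rp)
  ...     | inj₂ b = Between-in-one-tree i≢j b
                       (edge⇒Route j ex , rq , λ x≡rq → x≢rp (trans x≡rq (sym rp≡rq)))

  Inner-elsewhere : ∀ {a b} → b ≢ a → ∀ {z x} → z ≢ x → Σ (Fin n) λ t → Inner a t × t ≢ z
  Inner-elsewhere {a} {b} b≢a {z} z≢x with toward b z≢x
  ... | route y zy _ _ with walk⇒path a (T-conn (Ts a) y z)
  ... | []         , _  = ⊥-elim (edge⇒≢ b zy refl)
  ... | e ∷ []     , _  = ⊥-elim (edge-in-one-tree b≢a zy (edge-sym a e))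
  ... | e ∷ e′ ∷ w , !p = _ , second-Inner a e e′ w !p

  module LowDegree {v u : Fin n} (v≢u : v ≢ u) (deg≤k : ∣ nbhd G v ∣ ≤ k) where

    exit : Fin k → Fin n
    exit i = next (toward i v≢u)

    exit-edge : ∀ i → Edge (T (Ts i)) v (exit i)
    exit-edge i = step (toward i v≢u)

    exit-injective : ∀ {i j} → exit i ≡ exit j → i ≡ j
    exit-injective {i} {j} eq with i ≟ j
    ... | yes i≡j = i≡j
    ... | no  i≢j = ⊥-elim (edge-in-one-tree i≢j (exit-edge i)
                              (subst (Edge (T (Ts j)) v) (sym eq) (exit-edge j)))

    neighbour-is-exit : ∀ {x} → adj G v x ≡ true → ¬ (∀ i → x ≢ exit i)
    neighbour-is-exit {x} v~x x≢exits =
      1+n≰n (≤-trans (subst (λ m → suc m ≤ ∣ nbhd G v ∣) length-exits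
                              (length≤∣p∣ (nbhd G v) !x∷exits x∷exits⊆N))
                     deg≤k)
      where
      exits : List (Fin n)
      exits = map exit (allFin k)

      length-exits : length exits ≡ k
      length-exits = trans (length-map exit (allFin k)) (length-tabulate {n = k} (λ i → i))

      !x∷exits : Unique (x ∷ exits)
      !x∷exits = ¬Any⇒All¬ exits (λ x∈ → let i , _ , x≡ = ∈-map⁻ exit x∈ in x≢exits i x≡)
               ∷ map⁺ exit-injective (allFin⁺ k)

      x∷exits⊆N : ∀ {y} → y ∈ x ∷ exits → y ∈ₛ nbhd G v
      x∷exits⊆N (here refl) = adj⇒∈nbhd G v~x
      x∷exits⊆N (there y∈) with ∈-map⁻ exit y∈
      ... | i , _ , refl = adj⇒∈nbhd G (T⊆G (Ts i) v (exit i) (exit-edge i))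

    tree-edge≡exit : ∀ i {h} → Edge (T (Ts i)) v h → h ≡ exit i
    tree-edge≡exit i {h} e with h ≟ exit i
    ... | yes h≡exit = h≡exit
    ... | no  h≢exit = ⊥-elim (neighbour-is-exit (T⊆G (Ts i) v h e) h≢exits)
      where
      h≢exits : ∀ j → h ≢ exit j
      h≢exits j h≡exit with j ≟ i
      ... | yes refl = h≢exit h≡exit
      ... | no  j≢i  =
        edge-in-one-tree j≢i (subst (Edge (T (Ts j)) v) (sym h≡exit) (exit-edge j)) e

    leaf : ∀ i → ¬ Inner i v
    leaf i (p , q , ep , eq , p≢q) = p≢q (trans (tree-edge≡exit i ep) (sym (tree-edge≡exit i eq)))

    edge-in-some-tree : ∀ {x} → adj G v x ≡ true → Σ (Fin k) λ i → Edge (T (Ts i)) v x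
    edge-in-some-tree {x} v~x with any? (λ i → x ≟ exit i)
    ... | yes (i , refl) = i , exit-edge i
    ... | no  ¬exit      = ⊥-elim (neighbour-is-exit v~x (λ i x≡exit → ¬exit (i , x≡exit)))

another : ∀ {k} → 2 ≤ k → (a : Fin k) → ∃ λ b → b ≢ a
another (s≤s (s≤s _)) a = punchIn a zero , punchInᵢ≢i a zero

module SplitCISTs {n k : ℕ} {G : Graph n} {inD : Fin n → Bool}
  (split : IsSplit G inD) (uniform : KUniform G inD k)
  {xD : Fin n} (xD∈D : inD xD ≡ true) (universal : ∀ x → inD x ≡ false → adj G xD x ≡ true)
  (Ts : Fin k → SpanningTree G) (cist : CompletelyIndependent Ts) where

  open CISTs Ts cist public
  open IsSplit split

  I≢D : ∀ {u v} → inD u ≡ false → inD v ≡ true → u ≢ v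
  I≢D u∈I v∈D refl with trans (sym u∈I) v∈D
  ... | ()

  I-leaf : ∀ {v} → inD v ≡ false → ∀ i → ¬ Inner i v
  I-leaf v∈I = LowDegree.leaf (I≢D v∈I xD∈D) (≤-reflexive (uniform _ v∈I))

  I-edge-in-some-tree : ∀ {v x} → inD v ≡ false → adj G x v ≡ true →
                        Σ (Fin k) λ i → Edge (T (Ts i)) v x
  I-edge-in-some-tree {v} {x} v∈I x~v =
    LowDegree.edge-in-some-tree (I≢D v∈I xD∈D) (≤-reflexive (uniform _ v∈I))
      (trans (Graph.sym G v x) x~v)

  I-neighbour⇒Inner : ∀ i {w z x} → inD w ≡ false → Edge (T (Ts i)) w z →
                      z ≢ x → w ≢ x → Inner i z
  I-neighbour⇒Inner i w∈I w~z z≢x =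
    leaf-neighbour⇒Inner i (edge-sym i w~z) (I-leaf w∈I i) (toward i z≢x)

  Inner-only-at-xD : ∀ {a w} → inD w ≡ false → Edge (T (Ts a)) w xD →
                     ∀ {t} → t ≢ xD → ¬ Inner a t
  Inner-only-at-xD {a} {w} w∈I w~xD {t} t≢xD innerᵃ with inD t in t∈
  ... | false = I-leaf t∈ a innerᵃ
  ... | true with D-has-I-nbr t t∈
  ... | w′ , w′∈I , t~w′ with I-edge-in-some-tree w′∈I t~w′
  ... | c , w′~t with c ≟ a
  ... | no c≢a =
    Inner-in-one-tree c≢a (I-neighbour⇒Inner c w′∈I w′~t t≢xD (I≢D w′∈I xD∈D)) innerᵃ
  ... | yes refl with I-edge-in-some-tree w′∈I (universal w′ w′∈I)
  ... | a′ , w′~xD with a′ ≟ a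
  ... | yes refl = I-leaf w′∈I a (t , xD , w′~t , w′~xD , t≢xD)
  ... | no a′≢a =
    Inner-in-one-tree a′≢a (I-neighbour⇒Inner a′ w′∈I w′~xD xD≢t (I≢D w′∈I t∈))
                           (I-neighbour⇒Inner a w∈I w~xD xD≢t (I≢D w∈I t∈))
    where
    xD≢t : xD ≢ t
    xD≢t xD≡t = t≢xD (sym xD≡t)

proposition1 : (k n : ℕ) → 2 ≤ k → (G : Graph n) → (inD : Fin n → Bool) →
    IsSplit G inD → KUniform G inD k →
    (xD : Fin n) → inD xD ≡ true → (∀ x → inD x ≡ false → adj G xD x ≡ true) →
    ¬ (Σ (Fin k → SpanningTree G) CompletelyIndependent)
proposition1 k n 2≤k G inD split uniform xD xD∈D universal (Ts , cist) =
  let w , w∈I , xD~w    = IsSplit.D-has-I-nbr split xD xD∈D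
      a , w~xD          = I-edge-in-some-tree w∈I xD~w
      b , b≢a           = another 2≤k a
      t , innerᵃ , t≢xD = Inner-elsewhere b≢a (I≢D w∈I xD∈D ∘ sym)
  in Inner-only-at-xD w∈I w~xD t≢xD innerᵃ
  where open SplitCISTs split uniform xD∈D universal Ts cist
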